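{- Let $G$ be the $n\times n$ toroidal chess graph with $n$ arbitrarily large. Play Cops and Robbers on $G$ with a single cop who is a chief and a robber on foot. Then this single cop has a winning strategy; that is, $c(G)=1$.
   Context: The $n\times n$ toroidal chess graph has vertex set $\mathbb{Z}_n\times\mathbb{Z}_n$, where $(i,j)$ is row $i$, column $j$; indices are taken mod $n$. Two vertices are adjacent if they differ by $\pm1$ in exactly one coordinate and agree in the other. The paper assumes throughout this part that $n$ is arbitrarily large. Cops and Robbers with one robber is played as follows. The cops choose starting vertices, then the robber chooses a starting vertex. After that the cops and the robber alternate turns, cops first. On the cops' turn, each cop either stays or moves to one of its allowable vertices. On the robber's turn, the robber either stays or moves to one of his allowable vertices. The cops win if, after finitely many moves, some cop occupies the robber's vertex. A player on foot has as allowable vertices the four vertices adjacent to its current vertex. A cop is a chief (moves like a chess queen) if its allowable vertices are all other vertices in the same row, the same column, or the same diagonal as its current vertex, with rows, columns and diagonals wrapping mod $n$. The cop number $c(G)$ is the minimum number of cops for which the cops have a winning strategy, whatever the robber's starting position. -}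

module Defs where

open import Data.Nat using (ℕ; suc; _+_; _∸_; NonZero)
open import Data.Nat.DivMod using (_mod_)
open import Data.Fin using (Fin; toℕ)
open import Data.Product using (_×_; _,_; Σ)
open import Data.Sum using (_⊎_)
open import Relation.Binary.PropositionalEquality using (_≡_; _≢_)

-- Vertices of the n × n toroidal chess graph: (row , column) in ℤ_n × ℤ_n.
Vertex : ℕ → Set
Vertex n = Fin n × Fin n

module _ (n : ℕ) ⦃ _ : NonZero n ⦄ where

  succ : Fin n → Fin n
  succ i = (suc (toℕ i)) mod n

  diff : Fin n → Fin n → Fin n
  diff i j = (toℕ i + (n ∸ toℕ j)) mod n

  plus : Fin n → Fin n → Fin n
  plus i j = (toℕ i + toℕ j) mod n

  PlusMinusOne : Fin n → Fin n → Set
  PlusMinusOne a b = (b ≡ succ a) ⊎ (a ≡ succ b)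

  -- Adjacency in the toroidal chess graph (allowable vertices of a player on foot):
  -- differ by ±1 in exactly one coordinate and agree in the other.
  Adjacent : Vertex n → Vertex n → Set
  Adjacent (i , j) (i' , j') =
    (PlusMinusOne i i' × j ≡ j') ⊎ (i ≡ i' × PlusMinusOne j j')

  -- Same row, column, diagonal or anti-diagonal (all wrapping mod n).
  SameLine : Vertex n → Vertex n → Set
  SameLine (i , j) (i' , j') =
    (i ≡ i') ⊎ (j ≡ j') ⊎ (diff i j ≡ diff i' j') ⊎ (plus i j ≡ plus i' j')

  -- Allowable vertices of a chief (queen): all OTHER vertices on a common line.
  ChiefAllowable : Vertex n → Vertex n → Set
  ChiefAllowable c c' = c ≢ c' × SameLine c c'

  ChiefMove : Vertex n → Vertex n → Set
  ChiefMove c c' = c ≡ c' ⊎ ChiefAllowable c c'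

  RobberMove : Vertex n → Vertex n → Set
  RobberMove r r' = r ≡ r' ⊎ Adjacent r r'

  -- CopWins c r : with one chief cop at c, robber (on foot) at r, and the cop
  -- to move, the cop has a strategy that captures the robber after finitely
  -- many moves, whatever the robber does.  (Inductive = well-founded game tree.)
  data CopWins : Vertex n → Vertex n → Set where
    caught : ∀ {c r} → c ≡ r → CopWins c r
    move   : ∀ {c r} (c' : Vertex n) → ChiefMove c c' →
             (c' ≡ r ⊎ (∀ r' → RobberMove r r' → CopWins c' r')) →
             CopWins c r

  -- One chief cop wins: it chooses a start, then for every robber start
  -- (robber chooses second), the cop, moving first, wins.
  OneChiefWins : Set
  OneChiefWins = Σ (Vertex n) λ c₀ → ∀ r₀ → CopWins c₀ r₀

module Submission where

-- The strategy has two moves.  From (x , y) against a robber at (a , b) the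
-- queen first moves along its column to (a , y), into the robber's row.  If
-- the robber stays in that row it is caught at once.  Otherwise it stepped
-- vertically, and the queen moves along the row onto (a , b), the vertex the
-- robber just left.  Now the robber is at most two steps from the queen, and
-- the geometric heart of the proof is that every walk of length ≤ 2 from a
-- vertex c ends on a row, column, diagonal or anti-diagonal through c (or at c
-- itself), so the queen captures on its next move.

open import Defs
open import Data.Nat using (ℕ; suc; _+_; _∸_; _≤_; _%_; NonZero)
open import Data.Nat.Properties using (+-comm; +-assoc; +-suc; m∸n+n≡m; m+[n∸m]≡n; <⇒≤)
open import Data.Nat.DivMod using (_mod_; %-distribˡ-+; m%n%n≡m%n; [m+n]%n≡m%n; m%n≤n; m<n⇒m%n≡m)
open import Data.Fin using (Fin; toℕ)
open import Data.Fin.Properties using (toℕ-fromℕ<; toℕ-injective; toℕ<n) renaming (_≟_ to _≟ᶠ_)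
open import Data.Product using (∃; _,_)
open import Data.Product.Properties using (≡-dec)
open import Data.Sum using (_⊎_; inj₁; inj₂)
open import Relation.Nullary using (Dec; yes; no)
open import Relation.Binary.Bundles using (Setoid)
open import Relation.Binary.PropositionalEquality using (_≡_; refl; sym; trans; cong; subst₂; setoid)
import Relation.Binary.Construct.On as On
import Relation.Binary.Reasoning.Setoid as SetoidReasoning

module ModularArithmetic (n : ℕ) ⦃ _ : NonZero n ⦄ where

  ≋-setoid : Setoid _ _
  ≋-setoid = On.setoid (setoid ℕ) (_% n)

  open Setoid ≋-setoid public using () renaming (_≈_ to _≋_; sym to ≋-sym)
  open SetoidReasoning ≋-setoid

  ≋-+ʳ : ∀ {a b} c → a ≋ b → a + c ≋ b + c
  ≋-+ʳ {a} {b} c a≋b =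
    trans (%-distribˡ-+ a c n)
          (trans (cong (λ r → (r + c % n) % n) a≋b) (sym (%-distribˡ-+ b c n)))

  ≋-+ˡ : ∀ c {a b} → a ≋ b → c + a ≋ c + b
  ≋-+ˡ c {a} {b} a≋b = subst₂ _≋_ (+-comm a c) (+-comm b c) (≋-+ʳ c a≋b)

  +n-≋ : ∀ a → a + n ≋ a
  +n-≋ a = [m+n]%n≡m%n a n

  +-complement-≋ : ∀ a c → a + c + (n ∸ c % n) ≋ a
  +-complement-≋ a c = begin
    a + c + (n ∸ c % n)       ≈⟨ ≋-+ʳ (n ∸ c % n) (≋-+ˡ a (sym (m%n%n≡m%n c n))) ⟩
    a + c % n + (n ∸ c % n)   ≡⟨ +-assoc a (c % n) (n ∸ c % n) ⟩
    a + (c % n + (n ∸ c % n)) ≡⟨ cong (a +_) (m+[n∸m]≡n (m%n≤n c n)) ⟩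
    a + n                     ≈⟨ +n-≋ a ⟩
    a                         ∎

  ≋-+-cancelʳ : ∀ {a b} c → a + c ≋ b + c → a ≋ b
  ≋-+-cancelʳ {a} {b} c a+c≋b+c = begin
    a                     ≈⟨ ≋-sym (+-complement-≋ a c) ⟩
    a + c + (n ∸ c % n)   ≈⟨ ≋-+ʳ (n ∸ c % n) a+c≋b+c ⟩
    b + c + (n ∸ c % n)   ≈⟨ +-complement-≋ b c ⟩
    b                     ∎

  toℕ-mod-≋ : ∀ a → toℕ (a mod n) ≋ a
  toℕ-mod-≋ a = trans (cong (_% n) (toℕ-fromℕ< _)) (m%n%n≡m%n a n)

  toℕ-≋-injective : ∀ {u v : Fin n} → toℕ u ≋ toℕ v → u ≡ v
  toℕ-≋-injective {u} {v} u≋v =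
    toℕ-injective (trans (sym (m<n⇒m%n≡m (toℕ<n u))) (trans u≋v (m<n⇒m%n≡m (toℕ<n v))))

  diff-+-≋ : ∀ i j → toℕ (diff n i j) + toℕ j ≋ toℕ i
  diff-+-≋ i j = begin
    toℕ (diff n i j) + toℕ j      ≈⟨ ≋-+ʳ (toℕ j) (toℕ-mod-≋ (toℕ i + (n ∸ toℕ j))) ⟩
    toℕ i + (n ∸ toℕ j) + toℕ j   ≡⟨ +-assoc (toℕ i) (n ∸ toℕ j) (toℕ j) ⟩
    toℕ i + (n ∸ toℕ j + toℕ j)   ≡⟨ cong (toℕ i +_) (m∸n+n≡m (<⇒≤ (toℕ<n j))) ⟩
    toℕ i + n                     ≈⟨ +n-≋ (toℕ i) ⟩
    toℕ i                         ∎

  diff-succ-succ : ∀ i j → diff n (succ n i) (succ n j) ≡ diff n i j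
  diff-succ-succ i j = toℕ-≋-injective (≋-+-cancelʳ (toℕ (succ n j)) (begin
    toℕ (diff n (succ n i) (succ n j)) + toℕ (succ n j) ≈⟨ diff-+-≋ (succ n i) (succ n j) ⟩
    toℕ (succ n i)                     ≈⟨ toℕ-mod-≋ (suc (toℕ i)) ⟩
    suc (toℕ i)                        ≈⟨ ≋-+ˡ 1 (≋-sym (diff-+-≋ i j)) ⟩
    suc (d + toℕ j)                    ≡⟨ sym (+-suc d (toℕ j)) ⟩
    d + suc (toℕ j)                    ≈⟨ ≋-+ˡ d (≋-sym (toℕ-mod-≋ (suc (toℕ j)))) ⟩
    d + toℕ (succ n j)                 ∎))
    where d = toℕ (diff n i j)

  plus-succ-shift : ∀ i j → plus n (succ n i) j ≡ plus n i (succ n j)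
  plus-succ-shift i j = toℕ-≋-injective (begin
    toℕ (plus n (succ n i) j)   ≈⟨ toℕ-mod-≋ (toℕ (succ n i) + toℕ j) ⟩
    toℕ (succ n i) + toℕ j      ≈⟨ ≋-+ʳ (toℕ j) (toℕ-mod-≋ (suc (toℕ i))) ⟩
    suc (toℕ i) + toℕ j         ≡⟨ sym (+-suc (toℕ i) (toℕ j)) ⟩
    toℕ i + suc (toℕ j)         ≈⟨ ≋-+ˡ (toℕ i) (≋-sym (toℕ-mod-≋ (suc (toℕ j)))) ⟩
    toℕ i + toℕ (succ n j)      ≈⟨ ≋-sym (toℕ-mod-≋ (toℕ i + toℕ (succ n j))) ⟩
    toℕ (plus n i (succ n j))   ∎)

module ChiefStrategy (n : ℕ) ⦃ _ : NonZero n ⦄ where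

  open ModularArithmetic n using (diff-succ-succ; plus-succ-shift)

  Attacks : Vertex n → Vertex n → Set
  Attacks c r = c ≡ r ⊎ SameLine n c r

  _≟ᵛ_ : (u v : Vertex n) → Dec (u ≡ v)
  _≟ᵛ_ = ≡-dec _≟ᶠ_ _≟ᶠ_

  lineMove : ∀ {c c'} → SameLine n c c' → ChiefMove n c c'
  lineMove {c} {c'} onLine with c ≟ᵛ c'
  ... | yes c≡c' = inj₁ c≡c'
  ... | no c≢c'  = inj₂ (c≢c' , onLine)

  capture : ∀ {c r} → Attacks c r → CopWins n c r
  capture (inj₁ c≡r)   = caught c≡r
  capture (inj₂ onLine) = move _ (lineMove onLine) (inj₁ refl)

  step-attacked : ∀ {c r} → RobberMove n c r → Attacks c r
  step-attacked (inj₁ c≡r)                = inj₁ c≡r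
  step-attacked (inj₂ (inj₁ (_ , refl)))  = inj₂ (inj₂ (inj₁ refl))
  step-attacked (inj₂ (inj₂ (refl , _)))  = inj₂ (inj₁ refl)

  corner-attacked : ∀ {i i' j j'} → PlusMinusOne n i i' → PlusMinusOne n j j' →
                    Attacks (i , j) (i' , j')
  corner-attacked {i} {_} {j} (inj₁ refl) (inj₁ refl) = inj₂ (inj₂ (inj₂ (inj₁ (sym (diff-succ-succ i j)))))
  corner-attacked {_} {i'} {_} {j'} (inj₂ refl) (inj₂ refl) = inj₂ (inj₂ (inj₂ (inj₁ (diff-succ-succ i' j'))))
  corner-attacked {i} {_} {_} {j'} (inj₁ refl) (inj₂ refl) = inj₂ (inj₂ (inj₂ (inj₂ (sym (plus-succ-shift i j')))))
  corner-attacked {_} {i'} {j} (inj₂ refl) (inj₁ refl) = inj₂ (inj₂ (inj₂ (inj₂ (plus-succ-shift i' j))))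

  two-steps-attacked : ∀ {c r r'} → RobberMove n c r → RobberMove n r r' → Attacks c r'
  two-steps-attacked (inj₁ refl) second = step-attacked second
  two-steps-attacked first (inj₁ refl)  = step-attacked first
  two-steps-attacked (inj₂ (inj₁ (_ , refl))) (inj₂ (inj₁ (_ , refl))) = inj₂ (inj₂ (inj₁ refl))
  two-steps-attacked (inj₂ (inj₂ (refl , _))) (inj₂ (inj₂ (refl , _))) = inj₂ (inj₁ refl)
  two-steps-attacked (inj₂ (inj₁ (row , refl))) (inj₂ (inj₂ (refl , col))) = corner-attacked row col
  two-steps-attacked (inj₂ (inj₂ (refl , col))) (inj₂ (inj₁ (row , refl))) = corner-attacked row col

  chase-from-row : ∀ a y b {r} → RobberMove n (a , b) r → CopWins n (a , y) r
  chase-from-row a y b (inj₁ refl)              = capture (inj₂ (inj₁ refl))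
  chase-from-row a y b (inj₂ (inj₂ (refl , _))) = capture (inj₂ (inj₁ refl))
  chase-from-row a y b first@(inj₂ (inj₁ _))    =
    move (a , b) (lineMove (inj₁ refl)) (inj₂ λ _ second → capture (two-steps-attacked first second))

  chief-wins : ∀ c r → CopWins n c r
  chief-wins (x , y) (a , b) =
    move (a , y) (lineMove (inj₂ (inj₁ refl))) (inj₂ λ _ → chase-from-row a y b)

lemma2 : ∃ λ N → ∀ (n : ℕ) ⦃ _ : NonZero n ⦄ → N ≤ n → OneChiefWins n
lemma2 = 0 , λ n _ → (origin n , ChiefStrategy.chief-wins n (origin n))
  where
  origin : (n : ℕ) ⦃ _ : NonZero n ⦄ → Vertex n
  origin n = 0 mod n , 0 mod n
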